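{- Define $\kappa:\mathbb N\to\mathbb N$ by $$\kappa(n)=\begin{cases}\lfloor\varphi n+1\rfloor,& n\in R_{2,0},\\ \lfloor\varphi n-1\rfloor,& n\in R_{1,0},\\ \lfloor(\varphi-1)n+1\rfloor,& n\in R_{1,1}.\end{cases}$$ Then $\kappa$ is a permutation of $\mathbb N$, and its inverse is $$\kappa^{ -1}(n)=\begin{cases}\lfloor\varphi n\rfloor,& n\in R_{2,0}\cup R_{1,1},\\ \lfloor(\varphi-1)n+1\rfloor,& n\in R_{2,1},\\ \lfloor(\varphi-1)n\rfloor,& n\in R_{3,0}.\end{cases}$$
   Context: Let $\varphi=\frac{1+\sqrt5}{2}$ and $\mathbb N=\{1,2,3,\dots\}$; $a(n)=\lfloor n\varphi\rfloor$. $F$ is the Fibonacci sequence, $F(0)=0$, $F(1)=F(2)=1$, $F(n)=F(n-1)+F(n-2)$. For $i\in\mathbb Z^{\geq0}$, $j\in\mathbb Z$, let $f_{i,j}(n)=F(i+1)a(n)+F(i)n-j$ ($n\in\mathbb N$) and $R_{i,j}=\{f_{i,j}(n)\mid n\in\mathbb N\}$. The sets $R_{1,0},R_{1,1},R_{2,0}$ partition $\mathbb N$, and $R_{1,0}$ is the disjoint union of $R_{2,1}$ and $R_{3,0}$. -}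

module Defs where

open import Data.Nat as ℕ using (ℕ; zero; suc)
open import Data.Integer as ℤ using (ℤ; +_; _-_; _*_; _+_; ∣_∣)
open import Data.Bool using (Bool; true; false; _∧_; _∨_; if_then_else_)
open import Relation.Nullary.Decidable using (⌊_⌋)
open import Data.Product using (Σ; _×_; ∃-syntax)
open import Relation.Binary.PropositionalEquality using (_≡_)

F : ℕ → ℕ
F zero = 0
F (suc zero) = 1
F (suc (suc n)) = F (suc n) ℕ.+ F n

-- Exact comparison with numbers of the form p + q·φ, φ = (1+√5)/2.
-- leφ m p q = true  iff  m ≤ p + q φ.
-- m ≤ p + qφ  ⇔  L ≤ q√5  where L = 2(m−p) − q.
--   q ≥ 0 :  L ≤ q√5 ⇔ L ≤ 0 ∨ L² ≤ 5q²
--   q < 0 :  L ≤ q√5 ⇔ L < 0 ∧ 5q² ≤ L²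
leφ : ℤ → ℤ → ℤ → Bool
leφ m p q =
  let L = (+ 2) * (m - p) - q in
  if ⌊ + 0 ℤ.≤? q ⌋
  then ⌊ L ℤ.≤? + 0 ⌋ ∨ ⌊ L * L ℤ.≤? (+ 5) * (q * q) ⌋
  else ⌊ L ℤ.<? + 0 ⌋ ∧ ⌊ (+ 5) * (q * q) ℤ.≤? L * L ⌋

countLe : ℤ → ℤ → ℕ → ℕ
countLe p q zero = 0
countLe p q (suc B) = (if leφ (+ suc B) p q then 1 else 0) ℕ.+ countLe p q B

-- ⌊p + qφ⌋ for nonnegative p + qφ: since 0 ≤ p + qφ < B := |p| + 2|q| + 1,
-- ⌊x⌋ = #{ m ∈ {1,…,B} : m ≤ x }.
floorφ : ℤ → ℤ → ℕ
floorφ p q = countLe p q (∣ p ∣ ℕ.+ 2 ℕ.* ∣ q ∣ ℕ.+ 1)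

a : ℕ → ℕ
a n = floorφ (+ 0) (+ n)

f : ℕ → ℤ → ℕ → ℤ
f i j n = + (F (suc i) ℕ.* a n ℕ.+ F i ℕ.* n) - j

R : ℕ → ℤ → ℕ → Set
R i j n = ∃[ k ] (1 ℕ.≤ k × f i j k ≡ + n)

KappaSpec : (ℕ → ℕ) → Set
KappaSpec κ = (n : ℕ) → 1 ℕ.≤ n →
    (R 2 (+ 0) n → κ n ≡ floorφ (+ 1) (+ n))
  × (R 1 (+ 0) n → κ n ≡ floorφ (ℤ.- (+ 1)) (+ n))
  × (R 1 (+ 1) n → κ n ≡ floorφ (+ 1 - + n) (+ n))

KappaInvSpec : (ℕ → ℕ) → Set
KappaInvSpec κ' = (n : ℕ) → 1 ℕ.≤ n →
    (R 2 (+ 0) n → κ' n ≡ floorφ (+ 0) (+ n))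
  × (R 1 (+ 1) n → κ' n ≡ floorφ (+ 0) (+ n))
  × (R 2 (+ 1) n → κ' n ≡ floorφ (+ 1 - + n) (+ n))
  × (R 3 (+ 0) n → κ' n ≡ floorφ (ℤ.- (+ n)) (+ n))

-- Write a k = ⌊kφ⌋ and b k = a k + k = ⌊kφ²⌋. Then R₁,₀ = b ℕ⁺, R₁,₁ = a (a ℕ⁺) because
-- a (a k) = b k − 1, R₂,₀ = a (b ℕ⁺) because a (b k) = a k + b k, R₂,₁ = b (a ℕ⁺) and
-- R₃,₀ = b (b ℕ⁺). By Beatty's theorem ℕ⁺ = a ℕ⁺ ⊔ b ℕ⁺, so every n ≥ 1 is b k, a (a k) or a (b k),
-- and also a k, b (a k) or b (b k). On these forms the floor formulas evaluate to
--   κ (b k) = b (a k),   κ (a (a k)) = a k,   κ (a (b k)) = b (b k),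
-- and κ' reverses the three maps. All floors are decided exactly through the sign of
-- the integer form Q m n = m² − mn − n², with the irrationality of φ making the inequalities strict.
module Submission where

open import Defs
open import Data.Nat as ℕ using (ℕ; zero; suc; _≤_; _<_; s≤s; z≤n; _⊓_)
import Data.Nat.Properties as ℕP
open import Data.Nat.Induction using (<-rec)
open import Data.Integer as ℤ using (ℤ; +_; -[1+_]; _-_; _*_; _+_; -_; ∣_∣; +≤+; -≤+; -<+; +<+)
import Data.Integer.Properties as ℤP
open import Data.Integer.Tactic.RingSolver using (solve-∀)
import Data.Nat.Tactic.RingSolver as ℕ-Solver
open import Data.Bool using (true; false)
open import Data.Empty using (⊥-elim)
open import Data.Sum using (_⊎_; inj₁; inj₂; [_,_]′)
open import Data.Product using (_×_; _,_; proj₁; proj₂; ∃-syntax)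
open import Function.Bundles using (_⇔_; mk⇔; Equivalence)
import Function.Properties.Equivalence as ⇔
open import Relation.Nullary using (¬_; yes; no)
open import Relation.Unary using (Decidable)
open import Relation.Binary.PropositionalEquality

open Equivalence using (to; from)

Nonneg : ℤ → Set
Nonneg x = + 0 ℤ.≤ x

nonneg-≡ : ∀ {x y} → x ≡ y → Nonneg y → Nonneg x
nonneg-≡ refl p = p

ℕ-nonneg : ∀ n → Nonneg (+ n)
ℕ-nonneg n = +≤+ z≤n

+-nonneg : ∀ {x y} → Nonneg x → Nonneg y → Nonneg (x + y)
+-nonneg = ℤP.+-mono-≤

*-nonneg : ∀ {x y} → Nonneg x → Nonneg y → Nonneg (x * y)
*-nonneg {+ m} {+ n} _ _ = nonneg-≡ (sym (ℤP.pos-* m n)) (ℕ-nonneg _)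

ℕ≤⇒nonneg-diff : ∀ {m n} → m ≤ n → Nonneg (+ n - + m)
ℕ≤⇒nonneg-diff m≤n = ℤP.i≤j⇒0≤j-i (+≤+ m≤n)

<⇒nonneg-diff-1 : ∀ {x y} → x ℤ.< y → Nonneg (y - x - + 1)
<⇒nonneg-diff-1 {x} {y} x<y =
  nonneg-≡ (sym (shuffle x y)) (ℤP.i≤j⇒0≤j-i (ℤP.i<j⇒suc[i]≤j x<y))
  where
  shuffle : ∀ x y → y - (+ 1 + x) ≡ y - x - + 1
  shuffle = solve-∀

nonneg-neg⇒≤0 : ∀ {x} → Nonneg (- x) → x ℤ.≤ + 0
nonneg-neg⇒≤0 {x} = ℤP.neg-cancel-≤ {+ 0} {x}

≤0⇒nonneg-neg : ∀ {x} → x ℤ.≤ + 0 → Nonneg (- x)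
≤0⇒nonneg-neg = ℤP.neg-mono-≤

-- Q m n = (m − φn)(m + n/φ), so for m, n ≥ 0 (not both 0) Q m n has the sign of m − φn.
-- The ring solver does not unfold Q: identities involving it are stated with Q written out.
Q : ℤ → ℤ → ℤ
Q m n = m * m - m * n - n * n

Q-shift : ∀ m n → Q (m + n) m ≡ - Q m n
Q-shift = ring
  where
  ring : ∀ m n → (m + n) * (m + n) - (m + n) * m - m * m ≡ - (m * m - m * n - n * n)
  ring = solve-∀

_≤φ·_ : ℕ → ℕ → Set
m ≤φ· n = Q (+ m) (+ n) ℤ.≤ + 0

_<φ·_ : ℕ → ℕ → Set
m <φ· n = Nonneg (- Q (+ m) (+ n) - + 1)

_>φ·_ : ℕ → ℕ → Set
m >φ· n = Nonneg (Q (+ m) (+ n) - + 1)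

-- d ≤ φn for an integer d (for d < 0 the sign of Q d n says nothing)
_≤ℤφ·_ : ℤ → ℕ → Set
d ≤ℤφ· n = d ℤ.< + 0 ⊎ Q d (+ n) ℤ.≤ + 0

leφ≡true⇔ : ∀ x p n → leφ x p (+ n) ≡ true ⇔ (x - p) ≤ℤφ· n
leφ≡true⇔ x p n = mk⇔ decode encode
  where
  -- with d = x − p, leφ tests  2d − n ≤ 0  or  (2d − n)² ≤ 5n², and (2d − n)² − 5n² = 4 Q d n
  square-gap : ∀ d n → + 5 * (n * n) - (+ 2 * d - n) * (+ 2 * d - n) ≡ + 4 * - (d * d - d * n - n * n)
  square-gap = solve-∀

  nonneg-4* : ∀ y → Nonneg (+ 4 * y) → Nonneg y
  nonneg-4* (+ m) _ = ℕ-nonneg m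

  2m≤n⇒Q≤0 : ∀ m → + 2 * + m - + n ℤ.≤ + 0 → Q (+ m) (+ n) ℤ.≤ + 0
  2m≤n⇒Q≤0 m 2m≤n = nonneg-neg⇒≤0 (nonneg-≡ (ring (+ m) (+ n))
    (+-nonneg (*-nonneg (ℕ-nonneg m) (+-nonneg (≤0⇒nonneg-neg 2m≤n) (ℕ-nonneg m)))
              (*-nonneg (ℕ-nonneg n) (ℕ-nonneg n))))
    where
    ring : ∀ m n → - (m * m - m * n - n * n) ≡ m * (- (+ 2 * m - n) + m) + n * n
    ring = solve-∀

  d<0⇒2d≤n : ∀ d → d ℤ.< + 0 → + 2 * d - + n ℤ.≤ + 0
  d<0⇒2d≤n d d<0 = nonneg-neg⇒≤0 (nonneg-≡ (ring d (+ n))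
    (+-nonneg (+-nonneg (*-nonneg (ℕ-nonneg 2) (<⇒nonneg-diff-1 d<0)) (ℕ-nonneg n)) (ℕ-nonneg 2)))
    where
    ring : ∀ d n → - (+ 2 * d - n) ≡ + 2 * (+ 0 - d - + 1) + n + + 2
    ring = solve-∀

  decode : leφ x p (+ n) ≡ true → (x - p) ≤ℤφ· n
  decode e with + 2 * (x - p) - + n ℤ.≤? + 0
  decode e | yes 2d≤n with x - p
  ... | -[1+ _ ] = inj₁ -<+
  ... | + m = inj₂ (2m≤n⇒Q≤0 m 2d≤n)
  decode e | no _ with (+ 2 * (x - p) - + n) * (+ 2 * (x - p) - + n) ℤ.≤? + 5 * (+ n * + n)
  ... | yes square≤ = inj₂ (nonneg-neg⇒≤0 (nonneg-4* _
                        (nonneg-≡ (sym (square-gap (x - p) (+ n))) (ℤP.i≤j⇒0≤j-i square≤))))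
  decode () | no _ | no _

  encode : (x - p) ≤ℤφ· n → leφ x p (+ n) ≡ true
  encode d≤ with + 2 * (x - p) - + n ℤ.≤? + 0
  ... | yes _ = refl
  encode (inj₁ d<0) | no 2d≰n = ⊥-elim (2d≰n (d<0⇒2d≤n (x - p) d<0))
  encode (inj₂ Q≤0) | no _ with (+ 2 * (x - p) - + n) * (+ 2 * (x - p) - + n) ℤ.≤? + 5 * (+ n * + n)
  ... | yes _ = refl
  ... | no square≰ = ⊥-elim (square≰ (ℤP.0≤i-j⇒j≤i
          (nonneg-≡ (square-gap (x - p) (+ n)) (*-nonneg (ℕ-nonneg 4) (≤0⇒nonneg-neg Q≤0)))))

countLe≡⊓ : ∀ p q T → (∀ m → 1 ≤ m → leφ (+ m) p q ≡ true ⇔ m ≤ T) → ∀ B → countLe p q B ≡ B ⊓ T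
countLe≡⊓ p q T counted⇔ zero = refl
countLe≡⊓ p q T counted⇔ (suc B) with leφ (+ suc B) p q in e
... | true = trans (cong suc (trans (countLe≡⊓ p q T counted⇔ B) (ℕP.m≤n⇒m⊓n≡m B≤T)))
                   (sym (ℕP.m≤n⇒m⊓n≡m 1+B≤T))
  where
  1+B≤T : suc B ≤ T
  1+B≤T = to (counted⇔ (suc B) (s≤s z≤n)) e
  B≤T : B ≤ T
  B≤T = ℕP.≤-trans (ℕP.n≤1+n B) 1+B≤T
... | false = trans (countLe≡⊓ p q T counted⇔ B)
                    (trans (ℕP.m≥n⇒m⊓n≡n T≤B) (sym (ℕP.m≥n⇒m⊓n≡n (ℕP.m≤n⇒m≤1+n T≤B))))
  where
  true≢false : true ≢ false
  true≢false ()
  T≤B : T ≤ B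
  T≤B = ℕP.≮⇒≥ λ B<T → true≢false (trans (sym (from (counted⇔ (suc B) (s≤s z≤n)) B<T)) e)

floorφ≡ : ∀ p n T → (∀ m → 1 ≤ m → leφ (+ m) p (+ n) ≡ true ⇔ m ≤ T) →
          T ≤ ∣ p ∣ ℕ.+ 2 ℕ.* n ℕ.+ 1 → floorφ p (+ n) ≡ T
floorφ≡ p n T counted⇔ T≤B = trans (countLe≡⊓ p (+ n) T counted⇔ _) (ℕP.m≥n⇒m⊓n≡n T≤B)

module _ {P : ℕ → Set} (P? : Decidable P) (P-pred : ∀ {m} → P (suc m) → P m) where

  downward-closed : ∀ {m n} → m ≤ n → P n → P m
  downward-closed {m} {zero} z≤n Pn = Pn
  downward-closed {m} {suc n} m≤1+n P1+n with m ℕ.≟ suc n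
  ... | yes refl = P1+n
  ... | no m≢1+n = downward-closed (ℕP.m<1+n⇒m≤n (ℕP.≤∧≢⇒< m≤1+n m≢1+n)) (P-pred P1+n)

  threshold : ∀ B → P 0 → ¬ P B → ∃[ T ] T < B × (∀ m → P m ⇔ m ≤ T)
  threshold zero P0 ¬P0 = ⊥-elim (¬P0 P0)
  threshold (suc B) P0 ¬P1+B with P? B
  ... | no ¬PB = let T , T<B , P⇔ = threshold B P0 ¬PB in T , ℕP.m≤n⇒m≤1+n T<B , P⇔
  ... | yes PB = B , ℕP.≤-refl , λ m → mk⇔ (m≤B m) (λ m≤B → downward-closed m≤B PB)
    where
    m≤B : ∀ m → P m → m ≤ B
    m≤B m Pm = ℕP.≮⇒≥ λ B<m → ¬P1+B (downward-closed B<m Pm)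

≤φ·? : ∀ n → Decidable (_≤φ· n)
≤φ·? n m = Q (+ m) (+ n) ℤ.≤? + 0

≤⇒≤φ· : ∀ m n → m ≤ n → m ≤φ· n
≤⇒≤φ· m n m≤n = nonneg-neg⇒≤0 (nonneg-≡ (ring (+ m) (+ n))
  (+-nonneg (*-nonneg (ℕ-nonneg m) (ℕ≤⇒nonneg-diff m≤n)) (*-nonneg (ℕ-nonneg n) (ℕ-nonneg n))))
  where
  ring : ∀ m n → - (m * m - m * n - n * n) ≡ m * (n - m) + n * n
  ring = solve-∀

≤φ·-pred : ∀ m n → suc m ≤φ· n → m ≤φ· n
≤φ·-pred m n 1+m≤φ·n with m ℕ.≤? n
... | yes m≤n = ≤⇒≤φ· m n m≤n
... | no m≰n = nonneg-neg⇒≤0 (nonneg-≡ (ring (+ m) (+ n))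
  (+-nonneg (+-nonneg (+-nonneg (≤0⇒nonneg-neg 1+m≤φ·n) (ℕ≤⇒nonneg-diff (ℕP.<⇒≤ (ℕP.≰⇒> m≰n))))
                      (ℕ-nonneg m)) (ℕ-nonneg 1)))
  where
  ring : ∀ m n → - (m * m - m * n - n * n)
               ≡ - ((+ 1 + m) * (+ 1 + m) - (+ 1 + m) * n - n * n) + (m - n) + m + + 1
  ring = solve-∀

>φ·⇒≰φ· : ∀ m n → m >φ· n → ¬ m ≤φ· n
>φ·⇒≰φ· m n m>φ·n m≤φ·n with ℤP.≤-trans (ℤP.0≤i-j⇒j≤i m>φ·n) m≤φ·n
... | +≤+ ()

≰φ·⇒>φ· : ∀ m n → ¬ m ≤φ· n → m >φ· n
≰φ·⇒>φ· m n m≰φ·n =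
  nonneg-≡ (cong (_- + 1) (sym (ℤP.+-identityʳ (Q (+ m) (+ n))))) (<⇒nonneg-diff-1 (ℤP.≰⇒> m≰φ·n))

<φ·⇒≤φ· : ∀ m n → m <φ· n → m ≤φ· n
<φ·⇒≤φ· m n m<φ·n = nonneg-neg⇒≤0 (nonneg-≡ (ring (- Q (+ m) (+ n))) (+-nonneg m<φ·n (ℕ-nonneg 1)))
  where
  ring : ∀ x → x ≡ x - + 1 + + 1
  ring = solve-∀

2n+1>φ·n : ∀ n → suc (n ℕ.+ n) >φ· n
2n+1>φ·n n = nonneg-≡ (ring (+ n)) (+-nonneg (*-nonneg (ℕ-nonneg n) (ℕ-nonneg n)) (*-nonneg (ℕ-nonneg 3) (ℕ-nonneg n)))
  where
  ring : ∀ n → (+ 1 + (n + n)) * (+ 1 + (n + n)) - (+ 1 + (n + n)) * n - n * n - + 1 ≡ n * n + + 3 * n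
  ring = solve-∀

+≤ℤφ·⇔≤φ· : ∀ m n → (+ m) ≤ℤφ· n ⇔ m ≤φ· n
+≤ℤφ·⇔≤φ· m n = mk⇔ (λ { (inj₁ (+<+ ())) ; (inj₂ m≤φ·n) → m≤φ·n }) inj₂

leφ≡true⇔≤φ· : ∀ m n → leφ (+ m) (+ 0) (+ n) ≡ true ⇔ m ≤φ· n
leφ≡true⇔≤φ· m n = ⇔.trans
  (subst (λ d → leφ (+ m) (+ 0) (+ n) ≡ true ⇔ d ≤ℤφ· n) (ℤP.+-identityʳ (+ m)) (leφ≡true⇔ (+ m) (+ 0) n))
  (+≤ℤφ·⇔≤φ· m n)

≤a⇔≤φ· : ∀ m n → m ≤ a n ⇔ m ≤φ· n
≤a⇔≤φ· m n = subst (λ t → m ≤ t ⇔ m ≤φ· n) (sym a≡T) (⇔.sym (≤φ·⇔≤T m))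
  where
  T-spec : ∃[ T ] T < suc (n ℕ.+ n) × (∀ m → m ≤φ· n ⇔ m ≤ T)
  T-spec = threshold (≤φ·? n) (λ {m} → ≤φ·-pred m n) (suc (n ℕ.+ n)) (≤⇒≤φ· 0 n z≤n)
             (>φ·⇒≰φ· (suc (n ℕ.+ n)) n (2n+1>φ·n n))
  T = proj₁ T-spec
  ≤φ·⇔≤T = proj₂ (proj₂ T-spec)

  2n+1≡ : ∀ n → suc (n ℕ.+ n) ≡ 2 ℕ.* n ℕ.+ 1
  2n+1≡ = ℕ-Solver.solve-∀

  a≡T : a n ≡ T
  a≡T = floorφ≡ (+ 0) n T (λ m _ → ⇔.trans (leφ≡true⇔≤φ· m n) (≤φ·⇔≤T m))
          (ℕP.≤-trans (ℕP.<⇒≤ (proj₁ (proj₂ T-spec))) (ℕP.≤-reflexive (2n+1≡ n)))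

a≤φ· : ∀ n → a n ≤φ· n
a≤φ· n = to (≤a⇔≤φ· (a n) n) ℕP.≤-refl

suc-a>φ· : ∀ n → suc (a n) >φ· n
suc-a>φ· n = ≰φ·⇒>φ· (suc (a n)) n λ a+1≤φ·n → ℕP.1+n≰n (from (≤a⇔≤φ· (suc (a n)) n) a+1≤φ·n)

a-unique : ∀ x n → x ≤φ· n → suc x >φ· n → a n ≡ x
a-unique x n x≤φ·n x+1>φ·n = ℕP.≤-antisym a≤x (from (≤a⇔≤φ· x n) x≤φ·n)
  where
  a≤x : a n ≤ x
  a≤x = ℕP.≮⇒≥ λ x<a → >φ·⇒≰φ· (suc x) n x+1>φ·n (to (≤a⇔≤φ· (suc x) n) x<a)

a≤2n : ∀ n → a n ≤ n ℕ.+ n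
a≤2n n = ℕP.≮⇒≥ λ 2n<a → >φ·⇒≰φ· (suc (n ℕ.+ n)) n (2n+1>φ·n n) (to (≤a⇔≤φ· (suc (n ℕ.+ n)) n) 2n<a)

n≤a : ∀ n → n ≤ a n
n≤a n = from (≤a⇔≤φ· n n) (≤⇒≤φ· n n ℕP.≤-refl)

≤ℤφ·⇔≤a : ∀ d n → d ≤ℤφ· n ⇔ d ℤ.≤ + a n
≤ℤφ·⇔≤a -[1+ k ] n = mk⇔ (λ _ → -≤+) (λ _ → inj₁ -<+)
≤ℤφ·⇔≤a (+ k) n = mk⇔ (λ k≤φ·n → +≤+ (from (≤a⇔≤φ· k n) (to (+≤ℤφ·⇔≤φ· k n) k≤φ·n)))
                      (λ { (+≤+ k≤a) → inj₂ (to (≤a⇔≤φ· k n) k≤a) })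

floorφ-eval : ∀ p n → Nonneg (p + + a n) → + floorφ p (+ n) ≡ p + + a n
floorφ-eval p n 0≤p+a = trans (cong +_ (floorφ≡ p n T counted⇔ T≤bound)) +T≡
  where
  T = ∣ p + + a n ∣
  +T≡ : + T ≡ p + + a n
  +T≡ = ℤP.0≤i⇒+∣i∣≡i 0≤p+a

  ring : ∀ x p y → y - (x - p) ≡ p + y - x
  ring = solve-∀

  -≤⇔≤+ : ∀ x y → x - p ℤ.≤ y ⇔ x ℤ.≤ p + y
  -≤⇔≤+ x y = mk⇔ (λ h → ℤP.0≤i-j⇒j≤i (nonneg-≡ (sym (ring x p y)) (ℤP.i≤j⇒0≤j-i h)))
                  (λ h → ℤP.0≤i-j⇒j≤i (nonneg-≡ (ring x p y) (ℤP.i≤j⇒0≤j-i h)))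

  counted⇔ : ∀ m → 1 ≤ m → leφ (+ m) p (+ n) ≡ true ⇔ m ≤ T
  counted⇔ m _ = ⇔.trans (leφ≡true⇔ (+ m) p n) (⇔.trans (≤ℤφ·⇔≤a (+ m - p) n)
                   (⇔.trans (-≤⇔≤+ (+ m) (+ a n))
                     (subst (λ t → + m ℤ.≤ t ⇔ m ≤ T) +T≡ (mk⇔ ℤP.drop‿+≤+ +≤+))))

  2n+1≡ : ∀ p n → p ℕ.+ (n ℕ.+ n) ℕ.+ 1 ≡ p ℕ.+ 2 ℕ.* n ℕ.+ 1
  2n+1≡ = ℕ-Solver.solve-∀

  T≤bound : T ≤ ∣ p ∣ ℕ.+ 2 ℕ.* n ℕ.+ 1
  T≤bound = ℕP.≤-trans (ℤP.∣i+j∣≤∣i∣+∣j∣ p (+ a n))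
              (ℕP.≤-trans (ℕP.m≤m+n _ 1)
                (ℕP.≤-trans (ℕP.+-monoˡ-≤ 1 (ℕP.+-monoʳ-≤ ∣ p ∣ (a≤2n n))) (ℕP.≤-reflexive (2n+1≡ ∣ p ∣ n))))

<φ·⇒+>φ· : ∀ m n → m <φ· n → (m ℕ.+ n) >φ· m
<φ·⇒+>φ· m n = nonneg-≡ (cong (_- + 1) (Q-shift (+ m) (+ n)))

+>φ·⇒<φ· : ∀ m n → (m ℕ.+ n) >φ· m → m <φ· n
+>φ·⇒<φ· m n = nonneg-≡ (cong (_- + 1) (sym (Q-shift (+ m) (+ n))))

+<φ·⇒>φ· : ∀ m n → (m ℕ.+ n) <φ· m → m >φ· n
+<φ·⇒>φ· m n = nonneg-≡ (cong (_- + 1)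
  (trans (sym (ℤP.neg-involutive (Q (+ m) (+ n)))) (cong -_ (sym (Q-shift (+ m) (+ n))))))

n>φ·0 : ∀ n → 1 ≤ n → n >φ· 0
n>φ·0 n 1≤n = nonneg-≡ (ring (+ n)) (+-nonneg (*-nonneg (ℕ-nonneg n) n-1≥0) n-1≥0)
  where
  n-1≥0 : Nonneg (+ n - + 1)
  n-1≥0 = ℕ≤⇒nonneg-diff 1≤n
  ring : ∀ n → n * n - n * + 0 - + 0 * + 0 - + 1 ≡ n * (n - + 1) + (n - + 1)
  ring = solve-∀

Q≡0⇒n<m : ∀ m n → 1 ≤ n → Q (+ m) (+ n) ≡ + 0 → n < m
Q≡0⇒n<m m n 1≤n Q≡0 = ℕP.≰⇒> λ m≤n → -1≱0 (subst (λ x → Nonneg (- x - + 1)) Q≡0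
  (nonneg-≡ (ring (+ m) (+ n))
    (+-nonneg (+-nonneg (*-nonneg (ℕ-nonneg m) (ℕ≤⇒nonneg-diff m≤n)) (*-nonneg (ℕ-nonneg n) n-1≥0)) n-1≥0)))
  where
  n-1≥0 : Nonneg (+ n - + 1)
  n-1≥0 = ℕ≤⇒nonneg-diff 1≤n
  -1≱0 : ¬ Nonneg (- + 0 - + 1)
  -1≱0 ()
  ring : ∀ m n → - (m * m - m * n - n * n) - + 1 ≡ m * (n - m) + n * (n - + 1) + (n - + 1)
  ring = solve-∀

-- φ is irrational: a solution of Q m n = 0 with n ≥ 1 would give the smaller solution (n, m − n).
Q≢0 : ∀ n m → 1 ≤ n → Q (+ m) (+ n) ≢ + 0
Q≢0 = <-rec (λ n → ∀ m → 1 ≤ n → Q (+ m) (+ n) ≢ + 0) descent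
  where
  descent : ∀ n → (∀ {r} → r < n → ∀ m → 1 ≤ r → Q (+ m) (+ r) ≢ + 0) →
            ∀ m → 1 ≤ n → Q (+ m) (+ n) ≢ + 0
  descent n smaller m 1≤n Q≡0 with ℕP.m≤n⇒∃[o]m+o≡n (ℕP.<⇒≤ (Q≡0⇒n<m m n 1≤n Q≡0))
  ... | r , refl = smaller (Q≡0⇒n<m n r 1≤r Q′≡0) n 1≤r Q′≡0
    where
    Q′≡0 : Q (+ n) (+ r) ≡ + 0
    Q′≡0 = trans (sym (ℤP.neg-involutive (Q (+ n) (+ r)))) (cong -_ (trans (sym (Q-shift (+ n) (+ r))) Q≡0))
    1≤r : 1 ≤ r
    1≤r = ℕP.n≢0⇒n>0 λ { refl → >φ·⇒≰φ· n 0 (n>φ·0 n 1≤n) (ℤP.≤-reflexive Q′≡0) }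

≤φ·⇒<φ· : ∀ m n → 1 ≤ n → m ≤φ· n → m <φ· n
≤φ·⇒<φ· m n 1≤n m≤φ·n = nonneg-≡ (cong (_- + 1) (sym (ℤP.+-identityˡ (- Q (+ m) (+ n)))))
  (<⇒nonneg-diff-1 (ℤP.≤∧≢⇒< m≤φ·n (Q≢0 n m 1≤n)))

2n>φ·n : ∀ n → 1 ≤ n → (n ℕ.+ n) >φ· n
2n>φ·n n 1≤n = nonneg-≡ (ring (+ n)) (+-nonneg (*-nonneg (ℕ-nonneg n) n-1≥0) n-1≥0)
  where
  n-1≥0 : Nonneg (+ n - + 1)
  n-1≥0 = ℕ≤⇒nonneg-diff 1≤n
  ring : ∀ n → (n + n) * (n + n) - (n + n) * n - n * n - + 1 ≡ n * (n - + 1) + (n - + 1)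
  ring = solve-∀

a<2n : ∀ n → 1 ≤ n → a n < n ℕ.+ n
a<2n n 1≤n = ℕP.≰⇒> λ 2n≤a → >φ·⇒≰φ· (n ℕ.+ n) n (2n>φ·n n 1≤n) (to (≤a⇔≤φ· (n ℕ.+ n) n) 2n≤a)

pred-shift-≤φ· : ∀ m n → suc m >φ· suc n → suc m ≤ suc n ℕ.+ suc n → (m ℕ.+ n) ≤φ· m
pred-shift-≤φ· m n m+1>φ· m+1≤2n+2 = nonneg-neg⇒≤0 (nonneg-≡ (ring (+ m) (+ n))
  (+-nonneg (+-nonneg m+1>φ· (ℕ≤⇒nonneg-diff m+1≤2n+2)) (ℕ-nonneg (suc n))))
  where
  ring : ∀ m n → - ((m + n) * (m + n) - (m + n) * m - m * m)
               ≡ ((+ 1 + m) * (+ 1 + m) - (+ 1 + m) * (+ 1 + n) - (+ 1 + n) * (+ 1 + n) - + 1)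
                 + ((+ 1 + n) + (+ 1 + n) - (+ 1 + m)) + (+ 1 + n)
  ring = solve-∀

≤φ·-double-shift : ∀ m n → m ≤φ· n → (m ℕ.+ m ℕ.+ n) ≤φ· (m ℕ.+ n)
≤φ·-double-shift m n = subst (ℤ._≤ + 0) (sym (ring (+ m) (+ n)))
  where
  ring : ∀ m n → (m + m + n) * (m + m + n) - (m + m + n) * (m + n) - (m + n) * (m + n)
               ≡ m * m - m * n - n * n
  ring = solve-∀

>φ·-double-shift : ∀ m n → suc m >φ· n → suc (m ℕ.+ m ℕ.+ n) >φ· (m ℕ.+ n)
>φ·-double-shift m n m+1>φ·n = nonneg-≡ (ring (+ m) (+ n))
  (+-nonneg (+-nonneg m+1>φ·n (ℕ-nonneg m)) (ℕ-nonneg (n ℕ.+ n)))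
  where
  ring : ∀ m n → (+ 1 + (m + m + n)) * (+ 1 + (m + m + n)) - (+ 1 + (m + m + n)) * (m + n)
                   - (m + n) * (m + n) - + 1
               ≡ ((+ 1 + m) * (+ 1 + m) - (+ 1 + m) * n - n * n - + 1) + m + (n + n)
  ring = solve-∀

b : ℕ → ℕ
b k = a k ℕ.+ k

-- If a k = kφ − θ with 0 < θ < 1, then φ · a k = b k − θ/φ and φ · b k = a k + b k + θ/φ².
a∘a : ∀ k → 1 ≤ k → suc (a (a k)) ≡ b k
a∘a k@(suc k′) 1≤k = trans (cong suc (a-unique (A ℕ.+ k′) A A+k′≤φ·A A+k>φ·A)) (sym (ℕP.+-suc A k′))
  where
  A = a k
  A+k′≤φ·A : (A ℕ.+ k′) ≤φ· A
  A+k′≤φ·A = pred-shift-≤φ· A k′ (suc-a>φ· k) (a<2n k 1≤k)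
  A+k>φ·A : suc (A ℕ.+ k′) >φ· A
  A+k>φ·A = subst (_>φ· A) (ℕP.+-suc A k′) (<φ·⇒+>φ· A k (≤φ·⇒<φ· A k 1≤k (a≤φ· k)))

a∘b : ∀ k → a (b k) ≡ a k ℕ.+ b k
a∘b k = trans (a-unique (a k ℕ.+ a k ℕ.+ k) (a k ℕ.+ k) (≤φ·-double-shift (a k) k (a≤φ· k)) (>φ·-double-shift (a k) k (suc-a>φ· k)))
              (ℕP.+-assoc (a k) (a k) k)

-- With a (n + 1) = n + 1 + j, the number n is a j if n ≤ φj and b (n − j) otherwise.
beatty-a : ∀ n j → 1 ≤ n → suc n ℕ.+ j ≡ a (suc n) → n ≤φ· j → 1 ≤ j × a j ≡ n
beatty-a n j 1≤n n+1+j≡a n≤φ·j = 1≤j , a-unique n j n≤φ·j n+1>φ·j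
  where
  n+1>φ·j : suc n >φ· j
  n+1>φ·j = +<φ·⇒>φ· (suc n) j
    (subst (_<φ· suc n) (sym n+1+j≡a) (≤φ·⇒<φ· (a (suc n)) (suc n) (s≤s z≤n) (a≤φ· (suc n))))
  1≤j : 1 ≤ j
  1≤j = ℕP.n≢0⇒n>0 λ { refl → >φ·⇒≰φ· n 0 (n>φ·0 n 1≤n) n≤φ·j }

beatty-b : ∀ n j o → suc j ℕ.+ o ≡ n → suc n ℕ.+ j ≡ a (suc n) → ¬ n ≤φ· j → b (suc o) ≡ n
beatty-b .(suc j ℕ.+ o) j o refl n+1+j≡a n≰φ·j =
  trans (cong (ℕ._+ i) (a-unique j i j≤φ·i j+1>φ·i)) (ℕP.+-suc j o)
  where
  i = suc o
  j≤φ·i : j ≤φ· i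
  j≤φ·i = <φ·⇒≤φ· j i (+>φ·⇒<φ· j i (subst (_>φ· j) (sym (ℕP.+-suc j o)) (≰φ·⇒>φ· (suc j ℕ.+ o) j n≰φ·j)))
  a[n+1]+1≡ : suc (a (suc (suc j ℕ.+ o))) ≡ (suc j ℕ.+ i) ℕ.+ suc j
  a[n+1]+1≡ = trans (cong suc (sym n+1+j≡a)) (ring j o)
    where
    ring : ∀ j o → suc (suc (suc j ℕ.+ o) ℕ.+ j) ≡ (suc j ℕ.+ suc o) ℕ.+ suc j
    ring = ℕ-Solver.solve-∀
  j+1>φ·i : suc j >φ· i
  j+1>φ·i = +<φ·⇒>φ· (suc j) i (+>φ·⇒<φ· (suc j ℕ.+ i) (suc j)
              (subst₂ _>φ·_ a[n+1]+1≡ (cong suc (sym (ℕP.+-suc j o))) (suc-a>φ· (suc (suc j ℕ.+ o)))))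

-- Beatty's theorem for φ and φ². A `with` on a term whose type mentions a makes Agda unfold the
-- count inside floorφ and exhaust memory; hence the helper function here and subst in a-or-b-ind.
a-or-b : ∀ n → 1 ≤ n → (∃[ j ] 1 ≤ j × a j ≡ n) ⊎ (∃[ i ] 1 ≤ i × b i ≡ n)
a-or-b n 1≤n = split (ℕP.m≤n⇒∃[o]m+o≡n (n≤a (suc n)))
  where
  split : ∃[ j ] suc n ℕ.+ j ≡ a (suc n) → (∃[ j ] 1 ≤ j × a j ≡ n) ⊎ (∃[ i ] 1 ≤ i × b i ≡ n)
  split (j , n+1+j≡a) with ≤φ·? j n
  ... | yes n≤φ·j = inj₁ (j , beatty-a n j 1≤n n+1+j≡a n≤φ·j)
  ... | no n≰φ·j = inj₂ (suc (proj₁ j<n) , s≤s z≤n , beatty-b n j (proj₁ j<n) (proj₂ j<n) n+1+j≡a n≰φ·j)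
    where
    j<n : ∃[ o ] suc j ℕ.+ o ≡ n
    j<n = ℕP.m≤n⇒∃[o]m+o≡n (ℕP.≰⇒> λ n≤j → n≰φ·j (≤⇒≤φ· n j n≤j))

a-or-b-ind : (P : ℕ → Set) → (∀ j → 1 ≤ j → P (a j)) → (∀ j → 1 ≤ j → P (b j)) → ∀ n → 1 ≤ n → P n
a-or-b-ind P Pa Pb n 1≤n =
  [ (λ (j , 1≤j , aj≡n) → subst P aj≡n (Pa j 1≤j)) , (λ (j , 1≤j , bj≡n) → subst P bj≡n (Pb j 1≤j)) ]′
  (a-or-b n 1≤n)

floorφ-shift : ∀ n c d → d ≤ a n ℕ.+ c → floorφ (+ c - + d) (+ n) ℕ.+ d ≡ a n ℕ.+ c
floorφ-shift n c d d≤a+c = ℤP.+-injective (begin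
  + floorφ p (+ n) + + d  ≡⟨ cong (_+ + d) (floorφ-eval p n 0≤p+a) ⟩
  p + + a n + + d         ≡⟨ ring (+ c) (+ d) (+ a n) ⟩
  + a n + + c             ∎)
  where
  open ≡-Reasoning
  p = + c - + d
  ring : ∀ c d x → c - d + x + d ≡ x + c
  ring = solve-∀
  ring′ : ∀ c d x → c - d + x ≡ x + c - d
  ring′ = solve-∀
  0≤p+a : Nonneg (p + + a n)
  0≤p+a = nonneg-≡ (ring′ (+ c) (+ d) (+ a n)) (ℕ≤⇒nonneg-diff d≤a+c)

floorφ[1] : ∀ n → floorφ (+ 1) (+ n) ≡ suc (a n)
floorφ[1] n = trans (sym (ℕP.+-identityʳ _)) (trans (floorφ-shift n 1 0 z≤n) (ℕP.+-comm (a n) 1))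

floorφ[-1] : ∀ n → 1 ≤ a n → suc (floorφ (- + 1) (+ n)) ≡ a n
floorφ[-1] n 1≤a = trans (ℕP.+-comm 1 _) (trans (floorφ-shift n 0 1 (ℕP.≤-trans 1≤a (ℕP.m≤m+n _ 0)))
                                                (ℕP.+-identityʳ (a n)))

floorφ[1-n] : ∀ n → floorφ (+ 1 - + n) (+ n) ℕ.+ n ≡ suc (a n)
floorφ[1-n] n = trans (floorφ-shift n 1 n (ℕP.≤-trans (n≤a n) (ℕP.m≤m+n _ 1))) (ℕP.+-comm (a n) 1)

floorφ[-n] : ∀ n → floorφ (- + n) (+ n) ℕ.+ n ≡ a n
floorφ[-n] n = subst (λ p → floorφ p (+ n) ℕ.+ n ≡ a n) (ℤP.+-identityˡ (- + n))
  (trans (floorφ-shift n 0 n (ℕP.≤-trans (n≤a n) (ℕP.m≤m+n _ 0))) (ℕP.+-identityʳ (a n)))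

R-intro : ∀ i j k n → 1 ≤ k → F (suc i) ℕ.* a k ℕ.+ F i ℕ.* k ≡ n ℕ.+ j → R i (+ j) n
R-intro i j k n 1≤k e = k , 1≤k , trans (cong (λ t → + t - + j) e) (ring (+ n) (+ j))
  where
  ring : ∀ n j → n + j - j ≡ n
  ring = solve-∀

b∈R₁₀ : ∀ k → 1 ≤ k → R 1 (+ 0) (b k)
b∈R₁₀ k 1≤k = R-intro 1 0 k (b k) 1≤k (ring (a k) k)
  where
  ring : ∀ x y → 1 ℕ.* x ℕ.+ 1 ℕ.* y ≡ x ℕ.+ y ℕ.+ 0
  ring = ℕ-Solver.solve-∀

a∘a∈R₁₁ : ∀ k → 1 ≤ k → R 1 (+ 1) (a (a k))
a∘a∈R₁₁ k 1≤k = R-intro 1 1 k _ 1≤k (trans (ring (a k) k) (trans (sym (a∘a k 1≤k)) (ℕP.+-comm 1 _)))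
  where
  ring : ∀ x y → 1 ℕ.* x ℕ.+ 1 ℕ.* y ≡ x ℕ.+ y
  ring = ℕ-Solver.solve-∀

a∘b∈R₂₀ : ∀ k → 1 ≤ k → R 2 (+ 0) (a (b k))
a∘b∈R₂₀ k 1≤k = R-intro 2 0 k _ 1≤k (trans (ring (a k) k) (cong (ℕ._+ 0) (sym (a∘b k))))
  where
  ring : ∀ x y → 2 ℕ.* x ℕ.+ 1 ℕ.* y ≡ x ℕ.+ (x ℕ.+ y) ℕ.+ 0
  ring = ℕ-Solver.solve-∀

b∘a∈R₂₁ : ∀ k → 1 ≤ k → R 2 (+ 1) (b (a k))
b∘a∈R₂₁ k 1≤k = R-intro 2 1 k _ 1≤k (begin
  2 ℕ.* a k ℕ.+ 1 ℕ.* k  ≡⟨ ring (a k) k ⟩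
  b k ℕ.+ a k            ≡⟨ cong (ℕ._+ a k) (sym (a∘a k 1≤k)) ⟩
  suc (a (a k)) ℕ.+ a k  ≡⟨ ring′ (a (a k)) (a k) ⟩
  b (a k) ℕ.+ 1          ∎)
  where
  open ≡-Reasoning
  ring : ∀ x y → 2 ℕ.* x ℕ.+ 1 ℕ.* y ≡ x ℕ.+ y ℕ.+ x
  ring = ℕ-Solver.solve-∀
  ring′ : ∀ z x → suc z ℕ.+ x ≡ z ℕ.+ x ℕ.+ 1
  ring′ = ℕ-Solver.solve-∀

b∘b∈R₃₀ : ∀ k → 1 ≤ k → R 3 (+ 0) (b (b k))
b∘b∈R₃₀ k 1≤k = R-intro 3 0 k _ 1≤k (trans (ring (a k) k) (cong (λ t → t ℕ.+ b k ℕ.+ 0) (sym (a∘b k))))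
  where
  ring : ∀ x y → 3 ℕ.* x ℕ.+ 2 ℕ.* y ≡ x ℕ.+ (x ℕ.+ y) ℕ.+ (x ℕ.+ y) ℕ.+ 0
  ring = ℕ-Solver.solve-∀

a∈R₁₁⊎R₂₀ : ∀ k → 1 ≤ k → R 1 (+ 1) (a k) ⊎ R 2 (+ 0) (a k)
a∈R₁₁⊎R₂₀ = a-or-b-ind (λ k → R 1 (+ 1) (a k) ⊎ R 2 (+ 0) (a k))
  (λ j 1≤j → inj₁ (a∘a∈R₁₁ j 1≤j)) (λ j 1≤j → inj₂ (a∘b∈R₂₀ j 1≤j))

a-pos : ∀ k → 1 ≤ k → 1 ≤ a k
a-pos k 1≤k = ℕP.≤-trans 1≤k (n≤a k)

b-pos : ∀ k → 1 ≤ k → 1 ≤ b k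
b-pos k 1≤k = ℕP.≤-trans 1≤k (ℕP.m≤n+m k (a k))

round-trip : ∀ (f g : ℕ → ℕ) {n m} → f n ≡ m → 1 ≤ m → g m ≡ n → 1 ≤ f n × g (f n) ≡ n
round-trip f g refl 1≤m gm≡n = 1≤m , gm≡n

module _ (κ κ' : ℕ → ℕ) (κ-spec : KappaSpec κ) (κ'-spec : KappaInvSpec κ') where
  open ≡-Reasoning

  κ-b : ∀ k → 1 ≤ k → κ (b k) ≡ b (a k)
  κ-b k 1≤k = ℕP.suc-injective (begin
    suc (κ (b k))                 ≡⟨ cong suc (proj₁ (proj₂ (κ-spec (b k) (b-pos k 1≤k))) (b∈R₁₀ k 1≤k)) ⟩
    suc (floorφ (- + 1) (+ b k))  ≡⟨ floorφ[-1] (b k) (a-pos (b k) (b-pos k 1≤k)) ⟩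
    a (b k)                       ≡⟨ a∘b k ⟩
    a k ℕ.+ b k                   ≡⟨ cong (a k ℕ.+_) (sym (a∘a k 1≤k)) ⟩
    a k ℕ.+ suc (a (a k))         ≡⟨ ℕP.+-suc (a k) (a (a k)) ⟩
    suc (a k ℕ.+ a (a k))         ≡⟨ cong suc (ℕP.+-comm (a k) (a (a k))) ⟩
    suc (b (a k))                 ∎)

  κ-a∘a : ∀ k → 1 ≤ k → κ (a (a k)) ≡ a k
  κ-a∘a k 1≤k = ℕP.+-cancelʳ-≡ n (κ n) (a k) (begin
    κ n ℕ.+ n                          ≡⟨ cong (ℕ._+ n) (proj₂ (proj₂ (κ-spec n 1≤n)) (a∘a∈R₁₁ k 1≤k)) ⟩
    floorφ (+ 1 - + n) (+ n) ℕ.+ n     ≡⟨ floorφ[1-n] n ⟩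
    suc (a n)                          ≡⟨ a∘a (a k) (a-pos k 1≤k) ⟩
    n ℕ.+ a k                          ≡⟨ ℕP.+-comm n (a k) ⟩
    a k ℕ.+ n                          ∎)
    where
    n = a (a k)
    1≤n = a-pos (a k) (a-pos k 1≤k)

  κ-a∘b : ∀ k → 1 ≤ k → κ (a (b k)) ≡ b (b k)
  κ-a∘b k 1≤k = begin
    κ (a (b k))                  ≡⟨ proj₁ (κ-spec (a (b k)) (a-pos (b k) (b-pos k 1≤k))) (a∘b∈R₂₀ k 1≤k) ⟩
    floorφ (+ 1) (+ a (b k))     ≡⟨ floorφ[1] (a (b k)) ⟩
    suc (a (a (b k)))            ≡⟨ a∘a (b k) (b-pos k 1≤k) ⟩
    b (b k)                      ∎

  κ'-a : ∀ k → 1 ≤ k → κ' (a k) ≡ a (a k)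
  κ'-a k 1≤k = [ proj₁ (proj₂ (κ'-spec (a k) (a-pos k 1≤k))) , proj₁ (κ'-spec (a k) (a-pos k 1≤k)) ]′
                 (a∈R₁₁⊎R₂₀ k 1≤k)

  κ'-b∘a : ∀ k → 1 ≤ k → κ' (b (a k)) ≡ b k
  κ'-b∘a k 1≤k = ℕP.+-cancelʳ-≡ n (κ' n) (b k) (begin
    κ' n ℕ.+ n                       ≡⟨ cong (ℕ._+ n) (proj₁ (proj₂ (proj₂ (κ'-spec n 1≤n))) (b∘a∈R₂₁ k 1≤k)) ⟩
    floorφ (+ 1 - + n) (+ n) ℕ.+ n   ≡⟨ floorφ[1-n] n ⟩
    suc (a n)                        ≡⟨ cong suc (a∘b (a k)) ⟩
    suc (a (a k)) ℕ.+ n              ≡⟨ cong (ℕ._+ n) (a∘a k 1≤k) ⟩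
    b k ℕ.+ n                        ∎)
    where
    n = b (a k)
    1≤n = b-pos (a k) (a-pos k 1≤k)

  κ'-b∘b : ∀ k → 1 ≤ k → κ' (b (b k)) ≡ a (b k)
  κ'-b∘b k 1≤k = ℕP.+-cancelʳ-≡ n (κ' n) (a (b k)) (begin
    κ' n ℕ.+ n                      ≡⟨ cong (ℕ._+ n) (proj₂ (proj₂ (proj₂ (κ'-spec n 1≤n))) (b∘b∈R₃₀ k 1≤k)) ⟩
    floorφ (- + n) (+ n) ℕ.+ n      ≡⟨ floorφ[-n] n ⟩
    a n                             ≡⟨ a∘b (b k) ⟩
    a (b k) ℕ.+ n                   ∎)
    where
    n = b (b k)
    1≤n = b-pos (b k) (b-pos k 1≤k)

  κ'∘κ : ∀ n → 1 ≤ n → 1 ≤ κ n × κ' (κ n) ≡ n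
  κ'∘κ = a-or-b-ind _ (a-or-b-ind _ on-a∘a on-a∘b) on-b
    where
    on-b : ∀ k → 1 ≤ k → 1 ≤ κ (b k) × κ' (κ (b k)) ≡ b k
    on-b k 1≤k = round-trip κ κ' (κ-b k 1≤k) (b-pos (a k) (a-pos k 1≤k)) (κ'-b∘a k 1≤k)
    on-a∘a : ∀ k → 1 ≤ k → 1 ≤ κ (a (a k)) × κ' (κ (a (a k))) ≡ a (a k)
    on-a∘a k 1≤k = round-trip κ κ' (κ-a∘a k 1≤k) (a-pos k 1≤k) (κ'-a k 1≤k)
    on-a∘b : ∀ k → 1 ≤ k → 1 ≤ κ (a (b k)) × κ' (κ (a (b k))) ≡ a (b k)
    on-a∘b k 1≤k = round-trip κ κ' (κ-a∘b k 1≤k) (b-pos (b k) (b-pos k 1≤k)) (κ'-b∘b k 1≤k)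

  κ∘κ' : ∀ n → 1 ≤ n → 1 ≤ κ' n × κ (κ' n) ≡ n
  κ∘κ' = a-or-b-ind _ on-a (a-or-b-ind _ on-b∘a on-b∘b)
    where
    on-a : ∀ k → 1 ≤ k → 1 ≤ κ' (a k) × κ (κ' (a k)) ≡ a k
    on-a k 1≤k = round-trip κ' κ (κ'-a k 1≤k) (a-pos (a k) (a-pos k 1≤k)) (κ-a∘a k 1≤k)
    on-b∘a : ∀ k → 1 ≤ k → 1 ≤ κ' (b (a k)) × κ (κ' (b (a k))) ≡ b (a k)
    on-b∘a k 1≤k = round-trip κ' κ (κ'-b∘a k 1≤k) (b-pos k 1≤k) (κ-b k 1≤k)
    on-b∘b : ∀ k → 1 ≤ k → 1 ≤ κ' (b (b k)) × κ (κ' (b (b k))) ≡ b (b k)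
    on-b∘b k 1≤k = round-trip κ' κ (κ'-b∘b k 1≤k) (a-pos (b k) (b-pos k 1≤k)) (κ-a∘b k 1≤k)

theorem4p5 : (κ κ' : ℕ → ℕ) → KappaSpec κ → KappaInvSpec κ' →
    ((n : ℕ) → 1 ≤ n → (1 ≤ κ n) × (κ' (κ n) ≡ n))
    × ((n : ℕ) → 1 ≤ n → (1 ≤ κ' n) × (κ (κ' n) ≡ n))
theorem4p5 κ κ' κ-spec κ'-spec = κ'∘κ κ κ' κ-spec κ'-spec , κ∘κ' κ κ' κ-spec κ'-spec
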